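{- For every finite set $\textsc{prop}$ of propositional variables and every $\mathrm{PL}_{\{\mathsf{3xor}\}}[\textsc{prop}]$-formula $\phi$, every set of labeled examples that uniquely characterizes $\phi$ with respect to $\mathrm{PL}_{\{\mathsf{3xor}\}}[\textsc{prop}]$ contains at least $|\textsc{prop}|-1$ examples.
   Context: $\mathsf{3xor}$ is the ternary Boolean function $x\oplus y\oplus z$. $\mathrm{PL}_{\{\mathsf{3xor}\}}[\textsc{prop}]$ is the set of propositional formulas built from variables in $\textsc{prop}$ using only the connective $\mathsf{3xor}$. A labeled example is a pair $(V,\mathrm{lab})$ with $V$ a truth assignment to $\textsc{prop}$ and $\mathrm{lab}\in\{0,1\}$; $\phi$ fits it if $\phi$ evaluates to $\mathrm{lab}$ under $V$. A set $E$ of labeled examples uniquely characterizes $\phi$ with respect to $\mathrm{PL}_{\{\mathsf{3xor}\}}[\textsc{prop}]$ if $\phi$ fits $E$ and every formula of $\mathrm{PL}_{\{\mathsf{3xor}\}}[\textsc{prop}]$ fitting $E$ is equivalent to $\phi$. -}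

module Defs where

open import Data.Nat using (ℕ)
open import Data.Fin using (Fin)
open import Data.Bool using (Bool; _xor_)
open import Data.Product using (_×_; proj₁; proj₂)
open import Data.List using (List)
open import Data.List.Relation.Unary.All using (All)
open import Relation.Binary.PropositionalEquality using (_≡_)

data Form (n : ℕ) : Set where
  var  : Fin n → Form n
  xor3 : Form n → Form n → Form n → Form n

Valuation : ℕ → Set
Valuation n = Fin n → Bool

eval : ∀ {n} → Form n → Valuation n → Bool
eval (var i) V = V i
eval (xor3 φ ψ χ) V = (eval φ V xor eval ψ V) xor eval χ V

Example : ℕ → Set
Example n = Valuation n × Bool

Fits : ∀ {n} → Form n → Example n → Set
Fits φ e = eval φ (proj₁ e) ≡ proj₂ e

FitsAll : ∀ {n} → Form n → List (Example n) → Set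
FitsAll φ E = All (Fits φ) E

Equiv : ∀ {n} → Form n → Form n → Set
Equiv φ ψ = ∀ V → eval φ V ≡ eval ψ V

UniquelyCharacterizes : ∀ {n} → List (Example n) → Form n → Set
UniquelyCharacterizes {n} E φ = FitsAll φ E × (∀ (ψ : Form n) → FitsAll ψ E → Equiv ψ φ)

SameExample : ∀ {n} → Example n → Example n → Set
SameExample e f = (∀ i → proj₁ e i ≡ proj₁ f i) × (proj₂ e ≡ proj₂ f)

module Submission where

-- Identify a valuation V with a vector in 𝔽₂ⁿ. For a vector x of even weight,
-- ψ = φ ⊕ ⨁_{x j} (p_j ⊕ p_0) is a 3xor-formula with ψ(V) = φ(V) ⊕ V·x, so ψ
-- agrees with φ exactly on the valuations orthogonal to x, and is inequivalent
-- to φ when x ≠ 0. If |E| < n - 1, the |E| + 1 vectors 1, V₁, …, V_|E| lie in a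
-- proper subspace of 𝔽₂ⁿ, and Gaussian elimination yields a nonzero x orthogonal
-- to all of them: ψ then fits E, so E does not characterize φ.

open import Defs
open import Algebra.Bundles using (CommutativeRing)
open import Data.Bool using (Bool; true; false; _∧_; _xor_; if_then_else_)
open import Data.Bool.Properties
  using (∧-comm; ∧-assoc; ∧-zeroʳ; ∧-distribˡ-xor; ∧-distribʳ-xor;
         xor-assoc; xor-comm; xor-same; xor-identityʳ; xor-∧-commutativeRing)
open import Algebra.Properties.CommutativeSemigroup
  (CommutativeRing.+-commutativeSemigroup xor-∧-commutativeRing) using (interchange)
open import Data.Empty using (⊥-elim)
open import Data.Fin using (Fin; zero; suc)
open import Data.Nat using (ℕ; zero; suc; _∸_; _≤_; _<_; z≤n; s≤s; s<s⁻¹; _≤?_)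
open import Data.Nat.Properties using (≰⇒>)
open import Data.List using (List; []; _∷_; length; map)
open import Data.List.Properties using (length-map)
open import Data.List.Relation.Unary.All as All using (All; []; _∷_)
open import Data.List.Relation.Unary.All.Properties using (map⁻)
open import Data.List.Relation.Unary.AllPairs using (AllPairs)
open import Data.List.Relation.Binary.Permutation.Propositional
  using (_↭_; ↭-refl; ↭-prep; ↭-swap; ↭-sym; ↭-trans)
open import Data.List.Relation.Binary.Permutation.Propositional.Properties
  using (All-resp-↭; ↭-length)
open import Data.Product using (∃₂; _×_; _,_; proj₁)
open import Data.Sum using (_⊎_; inj₁; inj₂)
open import Data.Vec.Functional as V using (Vector; head; tail; replicate; zipWith)
open import Function using (id)
open import Relation.Nullary using (¬_; yes; no)
open import Relation.Binary.PropositionalEquality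
  using (_≡_; refl; sym; trans; cong; cong₂; subst; module ≡-Reasoning)

infix 7 _·_

_·_ : ∀ {n} → Vector Bool n → Vector Bool n → Bool
_·_ {zero}  u v = false
_·_ {suc n} u v = (head u ∧ head v) xor (tail u · tail v)

·-comm : ∀ {n} (u v : Vector Bool n) → u · v ≡ v · u
·-comm {zero}  u v = refl
·-comm {suc n} u v = cong₂ _xor_ (∧-comm (head u) (head v)) (·-comm (tail u) (tail v))

·-zeroˡ : ∀ {n} (v : Vector Bool n) → replicate n false · v ≡ false
·-zeroˡ {zero}  v = refl
·-zeroˡ {suc n} v = ·-zeroˡ (tail v)

·-distribʳ-xor : ∀ {n} (u v w : Vector Bool n) →
  zipWith _xor_ u v · w ≡ (u · w) xor (v · w)
·-distribʳ-xor {zero}  u v w = refl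
·-distribʳ-xor {suc n} u v w =
  trans (cong₂ _xor_ (∧-distribʳ-xor (head w) (head u) (head v))
                     (·-distribʳ-xor (tail u) (tail v) (tail w)))
        (interchange (head u ∧ head w) (head v ∧ head w) (tail u · tail w) (tail v · tail w))

·-scaleˡ : ∀ {n} (c : Bool) (u v : Vector Bool n) → V.map (c ∧_) u · v ≡ c ∧ (u · v)
·-scaleˡ {zero}  c u v = sym (∧-zeroʳ c)
·-scaleˡ {suc n} c u v =
  trans (cong₂ _xor_ (∧-assoc c (head u) (head v)) (·-scaleˡ c (tail u) (tail v)))
        (sym (∧-distribˡ-xor c _ _))

unit : ∀ {n} → Fin n → Vector Bool n
unit zero    = true V.∷ replicate _ false
unit (suc j) = false V.∷ unit j

unit-· : ∀ {n} (j : Fin n) (x : Vector Bool n) → unit j · x ≡ x j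
unit-· zero    x = trans (cong (head x xor_) (·-zeroˡ (tail x))) (xor-identityʳ (head x))
unit-· (suc j) x = unit-· j (tail x)

Orthogonal : ∀ {n} → Vector Bool n → List (Vector Bool n) → Set
Orthogonal x vs = All (λ v → v · x ≡ false) vs

pivot : ∀ {n} (vs : List (Vector Bool (suc n))) →
  All (λ v → head v ≡ false) vs ⊎ ∃₂ λ w rest → head w ≡ true × vs ↭ w ∷ rest
pivot [] = inj₁ []
pivot (v ∷ vs) with head v in hv
... | true  = inj₂ (v , vs , hv , ↭-refl)
... | false with pivot vs
...   | inj₁ heads = inj₁ (hv ∷ heads)
...   | inj₂ (w , rest , hw , vs↭) =
        inj₂ (w , v ∷ rest , hw , ↭-trans (↭-prep v vs↭) (↭-swap v w ↭-refl))

eliminate : ∀ {n} → Vector Bool (suc n) → Vector Bool (suc n) → Vector Bool n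
eliminate w v = zipWith _xor_ (tail v) (V.map (head v ∧_) (tail w))

-- The pivot coordinate of the lifted vector is chosen to make it orthogonal to w.
lift : ∀ {n} → Vector Bool (suc n) → Vector Bool n → Vector Bool (suc n)
lift w y = (tail w · y) V.∷ y

eliminate-· : ∀ {n} (w v : Vector Bool (suc n)) (y : Vector Bool n) →
  eliminate w v · y ≡ v · lift w y
eliminate-· w v y = begin
  eliminate w v · y                                 ≡⟨ ·-distribʳ-xor (tail v) _ y ⟩
  (tail v · y) xor (V.map (head v ∧_) (tail w) · y) ≡⟨ cong ((tail v · y) xor_) (·-scaleˡ (head v) (tail w) y) ⟩
  (tail v · y) xor (head v ∧ (tail w · y))          ≡⟨ xor-comm (tail v · y) (head v ∧ (tail w · y)) ⟩
  v · lift w y                                      ∎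
  where open ≡-Reasoning

lift-orthogonal : ∀ {n} (w : Vector Bool (suc n)) → head w ≡ true →
  ∀ rest y → Orthogonal y (map (eliminate w) rest) → Orthogonal (lift w y) (w ∷ rest)
lift-orthogonal w hw rest y y⊥ =
  trans (cong (λ b → (b ∧ (tail w · y)) xor (tail w · y)) hw) (xor-same (tail w · y))
  ∷ All.map (λ {v} p → trans (sym (eliminate-· w v y)) p) (map⁻ {xs = rest} y⊥)

nonzero-orthogonal : ∀ n (vs : List (Vector Bool n)) → length vs < n →
  ∃₂ λ x j → x j ≡ true × Orthogonal x vs
nonzero-orthogonal zero    vs ()
nonzero-orthogonal (suc n) vs vs<n with pivot vs
... | inj₁ heads =
  unit zero , zero , refl ,
  All.map (λ {v} hv → trans (·-comm v (unit zero)) (trans (unit-· zero v) hv)) heads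
... | inj₂ (w , rest , hw , vs↭) with nonzero-orthogonal n (map (eliminate w) rest) rest<n
  where
  rest<n : length (map (eliminate w) rest) < n
  rest<n = subst (_< n) (sym (length-map (eliminate w) rest))
                 (s<s⁻¹ (subst (_< suc n) (↭-length vs↭) vs<n))
...   | y , j , yj , y⊥ =
  lift w y , suc j , yj , All-resp-↭ (↭-sym vs↭) (lift-orthogonal w hw rest y y⊥)

xorPairs : ∀ {N k} → Fin N → (Fin k → Fin N) → Vector Bool k → Form N → Form N
xorPairs {k = zero}  i₀ ι x φ = φ
xorPairs {k = suc k} i₀ ι x φ =
  xorPairs i₀ (tail ι) (tail x) (if head x then xor3 φ (var (head ι)) (var i₀) else φ)

eval-if-xor3 : ∀ {N} t (φ : Form N) a b V →
  eval (if t then xor3 φ (var a) (var b) else φ) V ≡ eval φ V xor (t ∧ (V a xor V b))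
eval-if-xor3 false φ a b V = sym (xor-identityʳ _)
eval-if-xor3 true  φ a b V = xor-assoc (eval φ V) (V a) (V b)

eval-xorPairs : ∀ {N k} (i₀ : Fin N) (ι : Fin k → Fin N) x φ V →
  eval (xorPairs i₀ ι x φ) V ≡ eval φ V xor ((λ j → V (ι j) xor V i₀) · x)
eval-xorPairs {k = zero}  i₀ ι x φ V = sym (xor-identityʳ _)
eval-xorPairs {k = suc k} i₀ ι x φ V = begin
  eval (xorPairs i₀ ι x φ) V                    ≡⟨ eval-xorPairs i₀ (tail ι) (tail x) _ V ⟩
  eval φ′ V xor rest                            ≡⟨ cong (_xor rest) (eval-if-xor3 (head x) φ (head ι) i₀ V) ⟩
  (eval φ V xor (head x ∧ head pairs)) xor rest ≡⟨ xor-assoc (eval φ V) (head x ∧ head pairs) rest ⟩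
  eval φ V xor ((head x ∧ head pairs) xor rest) ≡⟨ cong (λ b → eval φ V xor (b xor rest)) (∧-comm (head x) (head pairs)) ⟩
  eval φ V xor (pairs · x)                      ∎
  where
  open ≡-Reasoning
  φ′ = if head x then xor3 φ (var (head ι)) (var i₀) else φ
  pairs = λ j → V (ι j) xor V i₀
  rest = tail pairs · tail x

perturb : ∀ {n} → Vector Bool (suc n) → Form (suc n) → Form (suc n)
perturb = xorPairs zero id

eval-perturb : ∀ {n} (x : Vector Bool (suc n)) → replicate _ true · x ≡ false →
  ∀ φ V → eval (perturb x φ) V ≡ eval φ V xor (V · x)
eval-perturb x even φ V = begin
  eval (perturb x φ) V                                      ≡⟨ eval-xorPairs zero id x φ V ⟩
  eval φ V xor (zipWith _xor_ V (replicate _ (V zero)) · x) ≡⟨ cong (eval φ V xor_) (·-distribʳ-xor V (replicate _ (V zero)) x) ⟩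
  eval φ V xor ((V · x) xor (replicate _ (V zero) · x))     ≡⟨ cong (λ b → eval φ V xor ((V · x) xor b)) (replicate-· (V zero)) ⟩
  eval φ V xor ((V · x) xor false)                          ≡⟨ cong (eval φ V xor_) (xor-identityʳ (V · x)) ⟩
  eval φ V xor (V · x)                                      ∎
  where
  open ≡-Reasoning
  replicate-· : ∀ c → replicate _ c · x ≡ false
  replicate-· false = ·-zeroˡ x
  replicate-· true  = even

perturb-fits : ∀ {n} (x : Vector Bool (suc n)) → replicate _ true · x ≡ false →
  ∀ φ E → All (λ e → proj₁ e · x ≡ false) E → FitsAll φ E → FitsAll (perturb x φ) E
perturb-fits x even φ [] [] [] = []
perturb-fits x even φ (e ∷ E) (e⊥ ∷ E⊥) (fits ∷ fitsE) =
  trans (eval-perturb x even φ (proj₁ e))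
    (trans (cong (eval φ (proj₁ e) xor_) e⊥) (trans (xor-identityʳ _) fits))
  ∷ perturb-fits x even φ E E⊥ fitsE

perturb-inequivalent : ∀ {n} (x : Vector Bool (suc n)) → replicate _ true · x ≡ false →
  ∀ j → x j ≡ true → ∀ φ → ¬ Equiv (perturb x φ) φ
perturb-inequivalent x even j xj φ equiv = flip-≢ (eval φ U) (begin
  eval φ U xor true    ≡⟨ cong (eval φ U xor_) (sym (trans (unit-· j x) xj)) ⟩
  eval φ U xor (U · x) ≡⟨ sym (eval-perturb x even φ U) ⟩
  eval (perturb x φ) U ≡⟨ equiv U ⟩
  eval φ U             ∎)
  where
  open ≡-Reasoning
  U = unit j
  flip-≢ : ∀ b → ¬ (b xor true ≡ b)
  flip-≢ false ()
  flip-≢ true  ()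

theoremA3 : (n : ℕ) (φ : Form n) (E : List (Example n))
    → AllPairs (λ e f → ¬ SameExample e f) E
    → UniquelyCharacterizes E φ
    → n ∸ 1 ≤ length E
theoremA3 zero    φ E _ _ = z≤n
theoremA3 (suc n) φ E _ (φ-fits , unique) with n ≤? length E
... | yes n≤∣E∣ = n≤∣E∣
... | no  n≰∣E∣ with nonzero-orthogonal (suc n) (replicate _ true ∷ map proj₁ E) few
  where
  few : length (replicate _ true ∷ map proj₁ E) < suc n
  few = subst (λ m → suc m < suc n) (sym (length-map proj₁ E)) (s≤s (≰⇒> n≰∣E∣))
...   | x , j , xj , even ∷ x⊥E =
  ⊥-elim (perturb-inequivalent x even j xj φ
           (unique (perturb x φ) (perturb-fits x even φ E (map⁻ x⊥E) φ-fits)))
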